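{- Let $(B,\mathcal{S})$ be an instance of the 3-partition problem with $\mathcal{S}=(k_1,\dots,k_{3m})$, and let $d_1,\dots,d_{m+1},a_1,\dots,a_{3m}$ be distinct variables. Define $$A_{B,\mathcal{S}}=\bigwedge_{i=1}^{m}(d_{i+1}=d_i+B+1)\wedge\bigwedge_{j=1}^{3m}(d_1\le a_j)\wedge(a_j+k_j<d_{m+1}) : \mathop{*}_{i=1}^{m+1}\mathsf{array}(d_i,0,0)*\mathop{*}_{j=1}^{3m}\mathsf{array}(a_j,1,k_j),$$ $$\widetilde A_{B,\mathcal{S}}=\bigwedge_{i=1}^{m}(d_{i+1}=d_i+B+1):\mathop{*}_{i=1}^{m+1}\mathsf{array}(d_i,0,0),$$ $$\widetilde B_{B,\mathcal{S}}=\bigwedge_{i=1}^{m}(d_{i+1}>d_i)\wedge\bigwedge_{j=1}^{3m}(d_1\le a_j)\wedge(a_j+k_j<d_{m+1}) : \mathop{*}_{i=1}^{m+1}\mathsf{array}(d_i,0,0)*\mathop{*}_{j=1}^{3m}\mathsf{array}(a_j,1,k_j).$$ Then $\beta(\widetilde A_{B,\mathcal{S}},\widetilde B_{B,\mathcal{S}})$ and $\gamma(A_{B,\mathcal{S}})$ are equivalent formulas of Presburger arithmetic.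
   Context: ASL: terms $t ::= x\mid n\mid t+t\mid n t$; pure formulas are conjunctions of $t=t,t\neq t,t\le t,t<t$; spatial formulas $F::=\mathsf{emp}\mid t\mapsto t\mid\mathsf{array}(t,t)\mid F*F$; quantifier-free symbolic heaps $\Pi:F$. Base-offset notation: $\mathsf{array}(b,i,j)$ abbreviates $\mathsf{array}(b+i,b+j)$. For quantifier-free $C$, $\lfloor C\rfloor$ replaces every $c\mapsto d$ by $\mathsf{array}(c,c)$; if $\lfloor C\rfloor=\Pi:\mathop{*}_{i=1}^N\mathsf{array}(\hat a_i,\hat b_i)$ then $\gamma(C)=\Pi\wedge\bigwedge_{i}\hat a_i\le\hat b_i\wedge\bigwedge_{i<j}((\hat b_i<\hat a_j)\vee(\hat b_j<\hat a_i))$. For $A=\Pi:\mathop{*}_{i=1}^n\mathsf{array}(a_i,b_i)*\mathop{*}_{i=1}^k t_i\mapsto u_i$ and $B=\Pi':\mathop{*}_{i=1}^m\mathsf{array}(c_i,d_i)*\mathop{*}_{i=1}^{\ell} v_i\mapsto w_i$, $\beta(A,B)=\gamma(A)\wedge\gamma(B)\wedge\bigwedge_{j\le\ell}\bigwedge_{i\le n}(v_j<a_i\vee v_j>b_i)\wedge\bigwedge_{i\le k}\bigwedge_{j\le\ell}(t_i\neq v_j\vee u_i=w_j)$. 3-partition instance: $B\in\mathbb{N}$ and $\mathcal{S}=(k_1,\dots,k_{3m})$ in $\mathbb{N}$ with $\sum_j k_j=mB$ and $B/4<k_j<B/2$ for all $j$. Two formulas are equivalent if they are satisfied by exactly the same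 valuations over $\mathbb{N}$. -}

module Defs where

open import Data.Nat using (ℕ; _+_; _*_; _≤_; _<_)
open import Data.Fin using (Fin; inject₁) renaming (suc to fsuc)
open import Data.List using (List; []; _∷_; map; concatMap; allFin; _++_)
open import Data.Vec as Vec using (Vec; lookup)
open import Data.Product using (_×_; _,_)
open import Data.Sum using (_⊎_)
open import Data.Unit using (⊤)
open import Relation.Binary.PropositionalEquality using (_≡_)
open import Relation.Nullary using (¬_)

data Term (V : Set) : Set where
  var  : V → Term V
  num  : ℕ → Term V
  _⊕_  : Term V → Term V → Term V
  _⊛_  : ℕ → Term V → Term V

data Atom (V : Set) : Set where
  _≐_ _≠′_ _≤′_ _<′_ : Term V → Term V → Atom V

data Form (V : Set) : Set where
  tt   : Form V
  atom : Atom V → Form V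
  _∧′_ : Form V → Form V → Form V
  _∨′_ : Form V → Form V → Form V

-- spatial atoms  t ↦ t | array(t,t); a spatial formula is a finite
-- separating conjunction of such atoms (emp = the empty list)
data SAtom (V : Set) : Set where
  _↦_   : Term V → Term V → SAtom V
  array : Term V → Term V → SAtom V

record SH (V : Set) : Set where
  constructor _∶_
  field
    pure    : List (Atom V)
    spatial : List (SAtom V)
open SH public

⟦_⟧t : ∀ {V} → Term V → (V → ℕ) → ℕ
⟦ var x ⟧t ρ = ρ x
⟦ num n ⟧t ρ = n
⟦ s ⊕ t ⟧t ρ = ⟦ s ⟧t ρ + ⟦ t ⟧t ρ
⟦ n ⊛ t ⟧t ρ = n * ⟦ t ⟧t ρ

⟦_⟧a : ∀ {V} → Atom V → (V → ℕ) → Set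
⟦ s ≐ t ⟧a ρ = ⟦ s ⟧t ρ ≡ ⟦ t ⟧t ρ
⟦ s ≠′ t ⟧a ρ = ¬ (⟦ s ⟧t ρ ≡ ⟦ t ⟧t ρ)
⟦ s ≤′ t ⟧a ρ = ⟦ s ⟧t ρ ≤ ⟦ t ⟧t ρ
⟦ s <′ t ⟧a ρ = ⟦ s ⟧t ρ < ⟦ t ⟧t ρ

⟦_⟧ : ∀ {V} → Form V → (V → ℕ) → Set
⟦ tt ⟧ ρ = ⊤
⟦ atom a ⟧ ρ = ⟦ a ⟧a ρ
⟦ φ ∧′ ψ ⟧ ρ = ⟦ φ ⟧ ρ × ⟦ ψ ⟧ ρ
⟦ φ ∨′ ψ ⟧ ρ = ⟦ φ ⟧ ρ ⊎ ⟦ ψ ⟧ ρ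

_≣_ : ∀ {V} → Form V → Form V → Set
φ ≣ ψ = ∀ ρ → (⟦ φ ⟧ ρ → ⟦ ψ ⟧ ρ) × (⟦ ψ ⟧ ρ → ⟦ φ ⟧ ρ)

⋀ : ∀ {V} → List (Form V) → Form V
⋀ []       = tt
⋀ (φ ∷ φs) = φ ∧′ ⋀ φs

⋀atoms : ∀ {V} → List (Atom V) → Form V
⋀atoms as = ⋀ (map atom as)

-- ⌊C⌋ on spatial atoms: c ↦ d becomes array(c,c); we return the bounds
floorS : ∀ {V} → SAtom V → Term V × Term V
floorS (c ↦ d)     = c , c
floorS (array a b) = a , b

pairs : ∀ {A : Set} → List A → List (A × A)
pairs []       = []
pairs (x ∷ xs) = map (x ,_) xs ++ pairs xs

γ : ∀ {V} → SH V → Form V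
γ C =
  ⋀atoms (pure C)
  ∧′ ( ⋀ (map (λ { (a , b) → atom (a ≤′ b) }) arrs)
  ∧′ ⋀ (map (λ { ((ai , bi) , (aj , bj)) → atom (bi <′ aj) ∨′ atom (bj <′ ai) }) (pairs arrs)) )
  where arrs = map floorS (spatial C)

arraysOf : ∀ {V} → List (SAtom V) → List (Term V × Term V)
arraysOf []               = []
arraysOf ((t ↦ u) ∷ F)    = arraysOf F
arraysOf (array a b ∷ F)  = (a , b) ∷ arraysOf F

ptsOf : ∀ {V} → List (SAtom V) → List (Term V × Term V)
ptsOf []               = []
ptsOf ((t ↦ u) ∷ F)    = (t , u) ∷ ptsOf F
ptsOf (array a b ∷ F)  = ptsOf F

β : ∀ {V} → SH V → SH V → Form V
β A B =
  γ A ∧′ ( γ B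
  ∧′ ( ⋀ (concatMap (λ { (v , w) → map (λ { (a , b) → atom (v <′ a) ∨′ atom (b <′ v) }) (arraysOf (spatial A)) }) (ptsOf (spatial B)))
  ∧′ ⋀ (concatMap (λ { (t , u) → map (λ { (v , w) → atom (t ≠′ v) ∨′ atom (u ≐ w) }) (ptsOf (spatial B)) }) (ptsOf (spatial A))) ) )

record ThreePartition (m : ℕ) : Set where
  field
    B     : ℕ
    ks    : Vec ℕ (3 * m)
    sumks : Vec.sum ks ≡ m * B
    lower : ∀ j → B < 4 * lookup ks j      -- B/4 < k_j
    upper : ∀ j → 2 * lookup ks j < B      -- k_j < B/2
open ThreePartition public

data Var (m : ℕ) : Set where
  d : Fin (Data.Nat.suc m) → Var m
  a : Fin (3 * m) → Var m

arrayBO : ∀ {V} → Term V → ℕ → Term V → SAtom V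
arrayBO b i j = array (b ⊕ num i) (b ⊕ j)

module _ {m : ℕ} (I : ThreePartition m) where

  private
    kT : Fin (3 * m) → Term (Var m)
    kT j = num (lookup (ks I) j)

  dEqs : List (Atom (Var m))
  dEqs = map (λ i → var (d (fsuc i)) ≐ ((var (d (inject₁ i)) ⊕ num (B I)) ⊕ num 1)) (allFin m)

  dGts : List (Atom (Var m))
  dGts = map (λ i → var (d (inject₁ i)) <′ var (d (fsuc i))) (allFin m)

  aBounds : List (Atom (Var m))
  aBounds = concatMap (λ j → (var (d Data.Fin.zero) ≤′ var (a j))
                           ∷ ((var (a j) ⊕ kT j) <′ var (d (Data.Fin.fromℕ m))) ∷ [])
                      (allFin (3 * m))

  dArrays : List (SAtom (Var m))
  dArrays = map (λ i → arrayBO (var (d i)) 0 (num 0)) (allFin (Data.Nat.suc m))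

  aArrays : List (SAtom (Var m))
  aArrays = map (λ j → arrayBO (var (a j)) 1 (kT j)) (allFin (3 * m))

  A-BS : SH (Var m)
  A-BS = (dEqs ++ aBounds) ∶ (dArrays ++ aArrays)

  Ã-BS : SH (Var m)
  Ã-BS = dEqs ∶ dArrays

  B̃-BS : SH (Var m)
  B̃-BS = (dGts ++ aBounds) ∶ (dArrays ++ aArrays)

module Submission where

-- None of the three symbolic heaps contains a points-to atom,
-- so the last two conjuncts of β are empty and β(Ã,B̃) is just γ(Ã) ∧ γ(B̃).
-- Every γ(Π : F) splits into the pure part Π and the "array constraints"
-- of F (each array has lower ≤ upper bound, distinct arrays are disjoint);
-- the latter depend only on F and are inherited by every prefix of F.
-- The three heaps share the pure conjuncts (d_1 ≤ a_j ∧ a_j + k_j < d_{m+1})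
-- and the spatial part, except that A and Ã fix the spacing
-- d_{i+1} = d_i + B + 1 while B̃ only asks d_i < d_{i+1}, which the spacing
-- implies.  Hence:
--   (⇒) take the spacing from γ(Ã) and everything else from γ(B̃);
--   (⇐) γ(A) gives the spacing and hence d_i < d_{i+1}, i.e. γ(B̃), and
--       restricting its array constraints to the d-arrays gives γ(Ã).

open import Defs
open import Data.Nat using (ℕ; _+_; _<_; s≤s)
open import Data.Nat.Properties using (m≤m+n; +-comm)
open import Data.Vec using (lookup)
open import Data.List using (List; []; _∷_; map; _++_; allFin)
open import Data.List.Properties using (map-++)
open import Data.List.Relation.Unary.All using (All; []; _∷_)
import Data.List.Relation.Unary.All as All
open import Data.List.Relation.Unary.All.Properties using (map⁺; map⁻; ++⁺; ++⁻; ++⁻ˡ)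
open import Data.Product using (_×_; _,_)
open import Data.Unit using (tt)
open import Function using (_∘_)
open import Relation.Binary.PropositionalEquality using (_≡_; refl; subst; cong; cong₂; module ≡-Reasoning)

module _ {V : Set} (ρ : V → ℕ) where

  ⋀-map⁻ : ∀ {X : Set} (f : X → Form V) (L : List X) →
           ⟦ ⋀ (map f L) ⟧ ρ → All (λ x → ⟦ f x ⟧ ρ) L
  ⋀-map⁻ f []      tt       = []
  ⋀-map⁻ f (x ∷ L) (p , ps) = p ∷ ⋀-map⁻ f L ps

  ⋀-map⁺ : ∀ {X : Set} (f : X → Form V) (L : List X) →
           All (λ x → ⟦ f x ⟧ ρ) L → ⟦ ⋀ (map f L) ⟧ ρ
  ⋀-map⁺ f []      []       = tt
  ⋀-map⁺ f (x ∷ L) (p ∷ ps) = p , ⋀-map⁺ f L ps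

  ⋀atoms-++⁻ : (Π Π′ : List (Atom V)) → ⟦ ⋀atoms (Π ++ Π′) ⟧ ρ →
               ⟦ ⋀atoms Π ⟧ ρ × ⟦ ⋀atoms Π′ ⟧ ρ
  ⋀atoms-++⁻ Π Π′ p with ++⁻ Π (⋀-map⁻ atom (Π ++ Π′) p)
  ... | q , q′ = ⋀-map⁺ atom Π q , ⋀-map⁺ atom Π′ q′

  ⋀atoms-++⁺ : (Π Π′ : List (Atom V)) → ⟦ ⋀atoms Π ⟧ ρ → ⟦ ⋀atoms Π′ ⟧ ρ →
               ⟦ ⋀atoms (Π ++ Π′) ⟧ ρ
  ⋀atoms-++⁺ Π Π′ p p′ =
    ⋀-map⁺ atom (Π ++ Π′) (++⁺ (⋀-map⁻ atom Π p) (⋀-map⁻ atom Π′ p′))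

All-map-prefix : ∀ {X Y : Set} {P : Y → Set} (f : X → Y) (xs ys : List X) →
                 All P (map f (xs ++ ys)) → All P (map f xs)
All-map-prefix f xs ys = map⁺ ∘ ++⁻ˡ xs ∘ map⁻

All-pairs-prefix : ∀ {X : Set} {P : X × X → Set} (xs ys : List X) →
                   All P (pairs (xs ++ ys)) → All P (pairs xs)
All-pairs-prefix []       ys p = []
All-pairs-prefix (x ∷ xs) ys p with ++⁻ (map (x ,_) (xs ++ ys)) p
... | heads , rest =
  ++⁺ (All-map-prefix (x ,_) xs ys heads) (All-pairs-prefix xs ys rest)

module _ {V : Set} (ρ : V → ℕ) where

  -- γ(Π : F) is Π together with constraints depending on F alone, so the
  -- pure part may be exchanged for any other one that holds.
  γ-repure : (Π Π′ : List (Atom V)) (F : List (SAtom V)) →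
             ⟦ ⋀atoms Π′ ⟧ ρ → ⟦ γ (Π ∶ F) ⟧ ρ → ⟦ γ (Π′ ∶ F) ⟧ ρ
  γ-repure Π Π′ F p′ (_ , arrayConstraints) = p′ , arrayConstraints

  -- The array constraints of F ++ G (bounds and pairwise disjointness)
  -- contain those of F.
  γ-restrict : (Π Π′ : List (Atom V)) (F G : List (SAtom V)) →
               ⟦ ⋀atoms Π′ ⟧ ρ → ⟦ γ (Π ∶ (F ++ G)) ⟧ ρ → ⟦ γ (Π′ ∶ F) ⟧ ρ
  γ-restrict Π Π′ F G p′ (_ , bounds , disjoint) =
    p′ , ⋀-map⁺ ρ _ _ (All-map-prefix floorS F G (⋀-map⁻ ρ _ _ bounds))
       , ⋀-map⁺ ρ _ _ (All-pairs-prefix (map floorS F) (map floorS G)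
                         (subst (All _ ∘ pairs) (map-++ floorS F G) (⋀-map⁻ ρ _ _ disjoint)))

ptsOf-++ : ∀ {V : Set} (F G : List (SAtom V)) → ptsOf (F ++ G) ≡ ptsOf F ++ ptsOf G
ptsOf-++ []                G = refl
ptsOf-++ ((t ↦ u) ∷ F)     G = cong ((t , u) ∷_) (ptsOf-++ F G)
ptsOf-++ (array l u ∷ F)   G = ptsOf-++ F G

ptsOf-arrays : ∀ {V X : Set} (lo hi : X → Term V) (L : List X) →
               ptsOf (map (λ x → array (lo x) (hi x)) L) ≡ []
ptsOf-arrays lo hi []      = refl
ptsOf-arrays lo hi (x ∷ L) = ptsOf-arrays lo hi L

module _ {V : Set} (ρ : V → ℕ) where

  β⇒γγ : (A B : SH V) → ⟦ β A B ⟧ ρ → ⟦ γ A ⟧ ρ × ⟦ γ B ⟧ ρ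
  β⇒γγ A B (γA , γB , _) = γA , γB

  -- ... and the remaining conjuncts range over points-to atoms, so for
  -- heaps built from arrays only β(A,B) is exactly γ(A) ∧ γ(B).
  γγ⇒β : (A B : SH V) → ptsOf (spatial A) ≡ [] → ptsOf (spatial B) ≡ [] →
         ⟦ γ A ⟧ ρ → ⟦ γ B ⟧ ρ → ⟦ β A B ⟧ ρ
  γγ⇒β A B noPtsA noPtsB γA γB rewrite noPtsA | noPtsB = γA , γB , tt , tt

spacing⇒increasing : (x y B : ℕ) → y ≡ x + B + 1 → x < y
spacing⇒increasing x y B refl rewrite +-comm (x + B) 1 = s≤s (m≤m+n x B)

module _ {m : ℕ} (I : ThreePartition m) where

  dArrays-noPts : ptsOf (dArrays I) ≡ []
  dArrays-noPts = ptsOf-arrays (λ i → var (d i) ⊕ num 0) (λ i → var (d i) ⊕ num 0) (allFin _)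

  aArrays-noPts : ptsOf (aArrays I) ≡ []
  aArrays-noPts = ptsOf-arrays (λ j → var (a j) ⊕ num 1) (λ j → var (a j) ⊕ num (lookup (ks I) j)) (allFin _)

  allArrays-noPts : ptsOf (dArrays I ++ aArrays I) ≡ []
  allArrays-noPts = begin
    ptsOf (dArrays I ++ aArrays I)        ≡⟨ ptsOf-++ (dArrays I) (aArrays I) ⟩
    ptsOf (dArrays I) ++ ptsOf (aArrays I) ≡⟨ cong₂ _++_ dArrays-noPts aArrays-noPts ⟩
    []                                     ∎
    where open ≡-Reasoning

  dEqs⇒dGts : ∀ ρ → ⟦ ⋀atoms (dEqs I) ⟧ ρ → ⟦ ⋀atoms (dGts I) ⟧ ρ
  dEqs⇒dGts ρ eqs =
    ⋀-map⁺ ρ atom (dGts I) (map⁺ (All.map (spacing⇒increasing _ _ (B I))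
                                         (map⁻ (⋀-map⁻ ρ atom (dEqs I) eqs))))

lemma34 : (m : ℕ) (I : ThreePartition m) → β (Ã-BS I) (B̃-BS I) ≣ γ (A-BS I)
lemma34 m I ρ = to , from
  where
  -- spacing from γ(Ã); bounds on the a_j and array constraints from γ(B̃)
  to : ⟦ β (Ã-BS I) (B̃-BS I) ⟧ ρ → ⟦ γ (A-BS I) ⟧ ρ
  to βÃB̃ with β⇒γγ ρ (Ã-BS I) (B̃-BS I) βÃB̃
  ... | (spacing , _) , γB̃@(pureB̃ , _) with ⋀atoms-++⁻ ρ (dGts I) (aBounds I) pureB̃
  ... | _ , bounds =
    γ-repure ρ (pure (B̃-BS I)) (pure (A-BS I)) (spatial (A-BS I))
      (⋀atoms-++⁺ ρ (dEqs I) (aBounds I) spacing bounds) γB̃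

  -- γ(Ã) restricts the array constraints of γ(A); γ(B̃) keeps them and
  -- weakens the spacing to d_i < d_{i+1}
  from : ⟦ γ (A-BS I) ⟧ ρ → ⟦ β (Ã-BS I) (B̃-BS I) ⟧ ρ
  from γA@(pureA , _) with ⋀atoms-++⁻ ρ (dEqs I) (aBounds I) pureA
  ... | spacing , bounds =
    γγ⇒β ρ (Ã-BS I) (B̃-BS I) (dArrays-noPts I) (allArrays-noPts I)
      (γ-restrict ρ (pure (A-BS I)) (dEqs I) (dArrays I) (aArrays I) spacing γA)
      (γ-repure ρ (pure (A-BS I)) (pure (B̃-BS I)) (spatial (A-BS I))
        (⋀atoms-++⁺ ρ (dGts I) (aBounds I) (dEqs⇒dGts I ρ spacing) bounds) γA)
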